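{- Let $n\ge 1$ and let $X=\{(i,X_i):1\le i\le n\}$ be an $n$-queens configuration on the ordinary $n\times n$ board. For each row $i$ let $a_i$ (resp. $b_i$) be the number of columns $j\ne X_i$ such that $r(i,j)=3$ (resp. $r(i,j)=2$). Then \[\sum_{i=1}^n (2a_i+b_i)\ \ge\ \frac{5}{4}n^2-6n.\]
   Context: The board has squares $(i,j)$, $1\le i,j\le n$ ($i$ the row, $j$ the column). An $n$-queens configuration $X=\{(i,X_i)\}$ has one queen per row, with no two queens sharing a column or a diagonal (a set of squares with $i-j$ constant or with $i+j$ constant). For a square $(i,j)$ with $j\neq X_i$, $r(i,j)$ denotes the number of rows $i'\neq i$ such that the queen $(i',X_{i'})$ shares a column or a diagonal with $(i,j)$ (this number is always $1$, $2$ or $3$). -}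

module Defs where

open import Data.Nat using (ℕ; _+_; _*_; _≟_)
open import Data.Fin using (Fin; toℕ)
open import Data.Integer as ℤ using (ℤ; +_)
open import Data.List using (List; length; filter; map)
open import Data.Nat.ListAction using (sum)
open import Data.List using () renaming (allFin to allFinL)
open import Data.Product using (_×_)
open import Data.Sum using (_⊎_)
open import Relation.Binary.PropositionalEquality using (_≡_)
open import Relation.Nullary using (¬_)
open import Relation.Nullary.Decidable using (_×-dec_; _⊎-dec_; ¬?)
open import Data.Fin.Properties using () renaming (_≟_ to _≟ᶠ_)

-- Squares are pairs (i , j) of Fin n (0-based rows/columns; shifting by 1
-- does not change differences or relative sums).
-- A configuration assigns to each row i the column X i of its queen.

dif : ∀ {n} → Fin n → Fin n → ℤ
dif i j = (+ toℕ i) ℤ.- (+ toℕ j)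

sm : ∀ {n} → Fin n → Fin n → ℕ
sm i j = toℕ i + toℕ j

SharesColOrDiag : ∀ {n} → Fin n → Fin n → Fin n → Fin n → Set
SharesColOrDiag i j i' j' = (j ≡ j') ⊎ ((dif i j ≡ dif i' j') ⊎ (sm i j ≡ sm i' j'))

IsQueens : ∀ {n} → (Fin n → Fin n) → Set
IsQueens {n} X = ∀ (i i' : Fin n) → ¬ (i ≡ i') → ¬ SharesColOrDiag i (X i) i' (X i')

r : ∀ {n} → (Fin n → Fin n) → Fin n → Fin n → ℕ
r {n} X i j = length (filter (λ i' → ¬? (i ≟ᶠ i') ×-dec
                 ((j ≟ᶠ X i') ⊎-dec ((dif i j ℤ.≟ dif i' (X i')) ⊎-dec (sm i j ≟ sm i' (X i')))))
                 (allFinL n))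

a : ∀ {n} → (Fin n → Fin n) → Fin n → ℕ
a {n} X i = length (filter (λ j → ¬? (j ≟ᶠ X i) ×-dec (r X i j ≟ 3)) (allFinL n))

b : ∀ {n} → (Fin n → Fin n) → Fin n → ℕ
b {n} X i = length (filter (λ j → ¬? (j ≟ᶠ X i) ×-dec (r X i j ≟ 2)) (allFinL n))

total : ∀ {n} → (Fin n → Fin n) → ℕ
total {n} X = sum (map (λ i → 2 * a X i + b X i) (allFinL n))

module Submission where

-- Let S = Σ_{i,j} r(i,j).  Since r ≤ 3 and r vanishes on the queens,
-- r(i,j) ≤ 2[r = 3] + [r = 2] + 1 off the queens, so S ≤ Σ_i (2a_i + b_i) + n².
-- Counting the pairs (square, attacking queen) by queen instead,
-- S = Σ_q V(q), where V(p,y) counts the squares off row p lying on the column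
-- or on one of the two diagonals through (p, y).  These three lines meet only
-- at (p, y), so V(p,y) + 3 ≥ n + D(p,y) + A(p,y), where D and A are the lengths
-- of the two diagonals; hence n² + Σ_q (D + A) ≤ S + 3n.
-- Conversely, the diagonals through a square are long unless it is near the
-- border: 4(D + A) ≥ 6n − pen(p) − pen(y) for a penalty pen living on the
-- outer quarter of the lines, with 2 Σ_y pen(y) ≤ n² + 8n.  As y = X_q runs
-- over a permutation, Σ_q 4(D + A) ≥ 5n² − 8n, and the four estimates
-- combine linearly to the claim.

open import Defs
open import Level using (Level)
open import Data.Nat using (ℕ; zero; suc; _+_; _*_; _∸_; _≤_; _<_; z≤n; s≤s; _≤?_; _<?_; ∣_-_∣)
  renaming (_≟_ to _≟ℕ_)
open import Data.Nat.Properties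
open import Data.Nat.Tactic.RingSolver using (solve; solve-∀)
open import Algebra.Properties.Semiring.Sum +-*-semiring
  using (sum; sum-syntax; ∑-distrib-+; ∑-comm; sum-cong-≗; *-distribˡ-sum; *-distribʳ-sum)
open import Data.Fin using (Fin; zero; suc; toℕ; fromℕ<; opposite)
open import Data.Fin.Properties
  using (toℕ-injective; toℕ-fromℕ<; toℕ<n; opposite-prop; opposite-involutive; nonZeroIndex)
  renaming (_≟_ to _≟ᶠ_; 0≢1+n to zero≢suc; suc-injective to fsuc-injective)
import Data.Integer as ℤ
open import Data.Integer using () renaming (+_ to ι)
import Data.Integer.Properties as ℤ
import Data.Integer.Tactic.RingSolver as ℤ-Solver
open import Data.List using (_∷_; []; length; filter; map; tabulate)
open import Data.Nat.ListAction using () renaming (sum to listSum)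
open import Data.Product using (_×_; _,_; ∃-syntax)
open import Data.Sum using (inj₁; inj₂)
open import Data.Empty using (⊥-elim)
open import Function using (_∘_; id)
open import Function.Definitions using (Injective)
open import Relation.Binary.PropositionalEquality
open import Relation.Nullary using (Dec; yes; no; ¬_)
open import Relation.Nullary.Decidable using (_×-dec_; _⊎-dec_; ¬?)

private
  variable
    ℓ ℓ′ : Level
    A : Set ℓ
    B : Set ℓ′

ind : Dec A → ℕ
ind (yes _) = 1
ind (no _)  = 0

ind-yes : (A? : Dec A) → A → ind A? ≡ 1
ind-yes (yes _) _  = refl
ind-yes (no ¬a) a  = ⊥-elim (¬a a)

ind-no : (A? : Dec A) → ¬ A → ind A? ≡ 0
ind-no (yes a) ¬a = ⊥-elim (¬a a)
ind-no (no _)  _  = refl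

ind-×-yes : (A? : Dec A) (B? : Dec B) → A → ind (A? ×-dec B?) ≡ ind B?
ind-×-yes (yes _) (yes _) _ = refl
ind-×-yes (yes _) (no _)  _ = refl
ind-×-yes (no ¬a) _       a = ⊥-elim (¬a a)

ind-×-≤ : (A? : Dec A) (B? : Dec B) → ind (A? ×-dec B?) ≤ ind B?
ind-×-≤ (yes a) B? = ≤-reflexive (ind-×-yes (yes a) B? a)
ind-×-≤ (no _)  B? = z≤n

ind-⊎-≤ : (A? : Dec A) (B? : Dec B) → ind (A? ⊎-dec B?) ≤ ind A? + ind B?
ind-⊎-≤ (yes _) _       = s≤s z≤n
ind-⊎-≤ (no _)  (yes _) = ≤-refl
ind-⊎-≤ (no _)  (no _)  = z≤n

ind-⊎-disjoint : (A? : Dec A) (B? : Dec B) → ¬ (A × B) → ind A? + ind B? ≤ ind (A? ⊎-dec B?)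
ind-⊎-disjoint (yes a) (yes b) disjoint = ⊥-elim (disjoint (a , b))
ind-⊎-disjoint (yes _) (no _)  _        = ≤-refl
ind-⊎-disjoint (no _)  (yes _) _        = ≤-refl
ind-⊎-disjoint (no _)  (no _)  _        = z≤n

-- A count k ≤ 3 which vanishes when B holds is bounded by
-- 2[¬B ∧ k = 3] + [¬B ∧ k = 2] + 1; this is how r enters the weights 2a + b.
weighted-≤ : (B? : Dec B) (k : ℕ) → k ≤ 3 → (B → k ≡ 0) →
             k ≤ 2 * ind (¬? B? ×-dec (k ≟ℕ 3)) + ind (¬? B? ×-dec (k ≟ℕ 2)) + 1
weighted-≤ (yes b) k _ vanish = ≤-trans (≤-reflexive (vanish b)) z≤n
weighted-≤ (no _) 0 _ _ = z≤n
weighted-≤ (no _) 1 _ _ = ≤-refl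
weighted-≤ (no _) 2 _ _ = ≤-refl
weighted-≤ (no _) 3 _ _ = ≤-refl
weighted-≤ (no _) (suc (suc (suc (suc _)))) (s≤s (s≤s (s≤s ()))) _

∑-mono : ∀ {n} {f g : Fin n → ℕ} → (∀ i → f i ≤ g i) → sum f ≤ sum g
∑-mono {zero}  _   = z≤n
∑-mono {suc n} f≤g = +-mono-≤ (f≤g zero) (∑-mono (f≤g ∘ suc))

∑-const : ∀ n k → ∑[ i < n ] k ≡ n * k
∑-const zero    k = refl
∑-const (suc n) k = cong (k +_) (∑-const n k)

∑-zero : ∀ {n} {f : Fin n → ℕ} → (∀ i → f i ≡ 0) → sum f ≡ 0
∑-zero {n} f≡0 = trans (sum-cong-≗ f≡0) (trans (∑-const n 0) (*-zeroʳ n))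

∑-distrib-+₃ : ∀ {n} (f g h : Fin n → ℕ) →
               ∑[ i < n ] (f i + (g i + h i)) ≡ sum f + (sum g + sum h)
∑-distrib-+₃ f g h = trans (∑-distrib-+ f _) (cong (sum f +_) (∑-distrib-+ g h))

∑-single : ∀ {n} (f : Fin n → ℕ) (k : Fin n) → f k ≤ sum f
∑-single f zero    = m≤m+n _ _
∑-single f (suc k) = ≤-trans (∑-single (f ∘ suc) k) (m≤n+m _ _)

∑-atMostOne : ∀ {n} {P : Fin n → Set ℓ} (P? : ∀ i → Dec (P i)) →
              (∀ {i j} → P i → P j → i ≡ j) → ∑[ i < n ] ind (P? i) ≤ 1
∑-atMostOne {n = zero}  P? unique = z≤n
∑-atMostOne {n = suc n} P? unique with P? zero
... | yes p₀ = ≤-reflexive (cong suc (∑-zero (λ i → ind-no (P? (suc i)) (zero≢suc ∘ unique p₀))))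
... | no _   = ∑-atMostOne (P? ∘ suc) (λ pᵢ pⱼ → fsuc-injective (unique pᵢ pⱼ))

-- Reindexing along an injective map does not increase a sum
-- (count each value f k by how many indices are sent to k).
∑-reindex-≤ : ∀ {n} (f : Fin n → ℕ) {Y : Fin n → Fin n} → Injective _≡_ _≡_ Y →
              ∑[ i < n ] f (Y i) ≤ sum f
∑-reindex-≤ {n} f {Y} Y-injective = begin
    ∑[ i < n ] f (Y i)
  ≤⟨ ∑-mono (λ i → ≤-trans (≤-reflexive (sym (hit i))) (∑-single (weight i) (Y i))) ⟩
    ∑[ i < n ] ∑[ k < n ] weight i k
  ≡⟨ ∑-comm weight ⟩
    ∑[ k < n ] ∑[ i < n ] weight i k
  ≡⟨ sum-cong-≗ (λ k → sym (*-distribʳ-sum (f k) (λ i → ind (Y i ≟ᶠ k)))) ⟩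
    ∑[ k < n ] ((∑[ i < n ] ind (Y i ≟ᶠ k)) * f k)
  ≤⟨ ∑-mono (λ k → *-monoˡ-≤ (f k) (∑-atMostOne (λ i → Y i ≟ᶠ k)
                                      (λ eᵢ eⱼ → Y-injective (trans eᵢ (sym eⱼ))))) ⟩
    ∑[ k < n ] (1 * f k)
  ≡⟨ sum-cong-≗ (λ k → *-identityˡ (f k)) ⟩
    sum f ∎
  where
  open ≤-Reasoning
  weight : Fin n → Fin n → ℕ
  weight i k = ind (Y i ≟ᶠ k) * f k
  hit : ∀ i → weight i (Y i) ≡ f (Y i)
  hit i = trans (cong (_* f (Y i)) (ind-yes (Y i ≟ᶠ Y i) refl)) (*-identityˡ (f (Y i)))

∑-interval : ∀ {n} (g : Fin n → ℕ) lo hi → hi ≤ n →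
             (∀ i → lo ≤ toℕ i → toℕ i < hi → 1 ≤ g i) → hi ≤ lo + sum g
∑-interval g lo zero _ _ = z≤n
∑-interval {suc n} g zero (suc hi) (s≤s hi≤n) pos =
  +-mono-≤ (pos zero z≤n (s≤s z≤n))
           (∑-interval (g ∘ suc) zero hi hi≤n (λ i _ i<hi → pos (suc i) z≤n (s≤s i<hi)))
∑-interval {suc n} g (suc lo) (suc hi) (s≤s hi≤n) pos =
  s≤s (≤-trans (∑-interval (g ∘ suc) lo hi hi≤n (λ i lo≤i i<hi → pos (suc i) (s≤s lo≤i) (s≤s i<hi)))
               (+-monoʳ-≤ lo (m≤n+m _ _)))

∑∑-rows : ∀ {n} {P : Fin n → Fin n → Set ℓ} (P? : ∀ i j → Dec (P i j)) lo hi → hi ≤ n →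
          (∀ i → lo ≤ toℕ i → toℕ i < hi → ∃[ j ] P i j) →
          hi ≤ lo + ∑[ i < n ] ∑[ j < n ] ind (P? i j)
∑∑-rows P? lo hi hi≤n inhabited =
  ∑-interval _ lo hi hi≤n (λ i lo≤i i<hi → row i (inhabited i lo≤i i<hi))
  where
  row : ∀ i → ∃[ j ] _ → 1 ≤ sum (λ j → ind (P? i j))
  row i (j , pij) = ≤-trans (≤-reflexive (sym (ind-yes (P? i j) pij))) (∑-single _ j)

length-filter : ∀ {n} {P : A → Set ℓ′} (P? : ∀ x → Dec (P x)) (f : Fin n → A) →
                length (filter P? (tabulate f)) ≡ ∑[ i < n ] ind (P? (f i))
length-filter {n = zero}  P? f = refl
length-filter {n = suc n} P? f with P? (f zero)
... | yes _ = cong suc (length-filter P? (f ∘ suc))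
... | no _  = length-filter P? (f ∘ suc)

listSum-map : ∀ {n} (g : A → ℕ) (f : Fin n → A) → listSum (map g (tabulate f)) ≡ ∑[ i < n ] g (f i)
listSum-map {n = zero}  g f = refl
listSum-map {n = suc n} g f = cong (g (f zero) +_) (listSum-map g (f ∘ suc))

-- A square (p, p + d) near the top-left corner (2p + d < n): its diagonal has
-- at least n − d squares and its antidiagonal at least 2p + d + 1.
near-corner : ∀ n p d α β t → n ≤ d + α → suc (p + (p + d)) ≤ β → 2 * n ≤ 8 * p + t →
              6 * n ≤ 4 * (α + β) + t
near-corner n p d α β t long-diag long-anti edge = begin
    6 * n
  ≡⟨ solve (n ∷ []) ⟩
    4 * n + 2 * n
  ≤⟨ +-mono-≤ (*-monoʳ-≤ 4 long-diag) edge ⟩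
    4 * (d + α) + (8 * p + t)
  ≡⟨ solve (d ∷ α ∷ p ∷ t ∷ []) ⟩
    4 * (α + (p + (p + d))) + t
  ≤⟨ +-monoˡ-≤ t (*-monoʳ-≤ 4 (+-monoʳ-≤ α (≤-trans (n≤1+n _) long-anti))) ⟩
    4 * (α + β) + t ∎
  where open ≤-Reasoning

-- A square (p, p + d) with 2p + d ≥ n, where n = p + d + 1 + m: its
-- antidiagonal has at least 2n − 1 − (2p + d) squares.
far-corner : ∀ n p d m α β t → suc (p + d) + m ≡ n →
             n ≤ d + α → n + n ≤ suc (p + (p + d)) + β → 2 * n ≤ 8 * m + t →
             6 * n ≤ 4 * (α + β) + t
far-corner n p d m α β t n≡ long-diag long-anti edge = +-cancelʳ-≤ (8 * n) _ _ (begin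
    6 * n + 8 * n
  ≡⟨ solve (n ∷ []) ⟩
    4 * n + 4 * (n + n) + 2 * n
  ≤⟨ +-mono-≤ (+-mono-≤ (*-monoʳ-≤ 4 long-diag) (*-monoʳ-≤ 4 long-anti)) edge ⟩
    4 * (d + α) + 4 * (suc (p + (p + d)) + β) + (8 * m + t)
  ≤⟨ m≤m+n _ 4 ⟩
    4 * (d + α) + 4 * (suc (p + (p + d)) + β) + (8 * m + t) + 4
  ≡⟨ solve (p ∷ d ∷ m ∷ α ∷ β ∷ t ∷ []) ⟩
    4 * (α + β) + t + 8 * (suc (p + d) + m)
  ≡⟨ cong (λ k → 4 * (α + β) + t + 8 * k) n≡ ⟩
    4 * (α + β) + t + 8 * n ∎)
  where open ≤-Reasoning

-- The pointwise bound for a square with coordinates lo ≤ hi (in some order),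
-- whose antidiagonal has index s = lo + hi, given lower bounds for the lengths
-- α, β of its diagonals and edge terms t₁, t₂ for lo and hi.
ordered-bound : ∀ n lo hi s α β t₁ t₂ → lo ≤ hi → hi < n → lo + hi ≡ s →
                n ≤ ∣ lo - hi ∣ + α →
                (s < n → suc s ≤ β) → (n ≤ s → n + n ≤ suc s + β) →
                2 * n ≤ 8 * lo + t₁ → 2 * n ≤ 8 * (n ∸ suc hi) + t₂ →
                6 * n ≤ 4 * (α + β) + (t₁ + t₂)
ordered-bound n lo hi s α β t₁ t₂ lo≤hi hi<n refl long-diag short-anti long-anti edge₁ edge₂
  with m≤n⇒∃[o]m+o≡n lo≤hi
... | d , refl = corner-cases (subst (λ k → n ≤ k + α) (∣m-m+n∣≡n lo d) long-diag)
  where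
  corner-cases : n ≤ d + α → 6 * n ≤ 4 * (α + β) + (t₁ + t₂)
  corner-cases long-diag′ with lo + (lo + d) <? n
  ... | yes s<n = ≤-trans (near-corner n lo d α β t₁ long-diag′ (short-anti s<n) edge₁)
                          (+-monoʳ-≤ (4 * (α + β)) (m≤m+n t₁ t₂))
  ... | no s≮n = ≤-trans (far-corner n lo d (n ∸ suc (lo + d)) α β t₂ (m+[n∸m]≡n hi<n)
                                     long-diag′ (long-anti (≮⇒≥ s≮n)) edge₂)
                         (+-monoʳ-≤ (4 * (α + β)) (m≤n+m t₂ t₁))

-- edge n k = max(0, 2n − 8k): positive only on the first n/4 lines.
edge : ℕ → ℕ → ℕ
edge n k = 2 * n ∸ 8 * k

edge-bound : ∀ n k → 2 * n ≤ 8 * k + edge n k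
edge-bound n k = m≤n+m∸n (2 * n) (8 * k)

penalty : ∀ {n} → Fin n → ℕ
penalty {n} k = edge n (toℕ k) + edge n (n ∸ suc (toℕ k))

-- 16 Σ_{k<m} max(0, c − 8k) ≤ c² + 16c: peel off k = 0 and shift c by 8.
∑-edge : ∀ m c → 16 * ∑[ k < m ] (c ∸ 8 * toℕ k) ≤ c * c + 16 * c
∑-edge zero    c = z≤n
∑-edge (suc m) c = begin
    16 * (c + ∑[ k < m ] (c ∸ 8 * suc (toℕ k)))
  ≡⟨ cong (λ t → 16 * (c + t)) (sum-cong-≗ (λ (k : Fin m) → shift (toℕ k))) ⟩
    16 * (c + ∑[ k < m ] ((c ∸ 8) ∸ 8 * toℕ k))
  ≡⟨ *-distribˡ-+ 16 c _ ⟩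
    16 * c + 16 * ∑[ k < m ] ((c ∸ 8) ∸ 8 * toℕ k)
  ≤⟨ +-monoʳ-≤ (16 * c) (≤-trans (∑-edge m (c ∸ 8)) (square-step c)) ⟩
    16 * c + c * c
  ≡⟨ +-comm (16 * c) (c * c) ⟩
    c * c + 16 * c ∎
  where
  open ≤-Reasoning
  shift : ∀ t → c ∸ 8 * suc t ≡ (c ∸ 8) ∸ 8 * t
  shift t = trans (cong (c ∸_) (*-suc 8 t)) (sym (∸-+-assoc c 8 (8 * t)))
  expand : ∀ w → w * w + 16 * w + 64 ≡ (8 + w) * (8 + w)
  expand = solve-∀
  square-step : ∀ c → (c ∸ 8) * (c ∸ 8) + 16 * (c ∸ 8) ≤ c * c
  square-step c with 8 ≤? c
  ... | yes 8≤c = subst (λ v → (c ∸ 8) * (c ∸ 8) + 16 * (c ∸ 8) ≤ v * v) (m+[n∸m]≡n 8≤c)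
                        (≤-trans (m≤m+n _ 64) (≤-reflexive (expand (c ∸ 8))))
  ... | no 8≰c rewrite m≤n⇒m∸n≡0 (<⇒≤ (≰⇒> 8≰c)) = z≤n

penaltySum : ℕ → ℕ
penaltySum n = ∑[ k < n ] penalty k

penalty-total : ∀ n → penaltySum n + penaltySum n ≤ n * n + 8 * n
penalty-total n = *-cancelˡ-≤ 16 (begin
    16 * (P + P)            ≤⟨ *-monoʳ-≤ 16 (+-mono-≤ P≤E+E P≤E+E) ⟩
    16 * ((E + E) + (E + E)) ≡⟨ quadruple E ⟩
    4 * (16 * E)            ≤⟨ *-monoʳ-≤ 4 (∑-edge n (2 * n)) ⟩
    4 * ((2 * n) * (2 * n) + 16 * (2 * n)) ≡⟨ solve (n ∷ []) ⟩
    16 * (n * n + 8 * n)    ∎)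
  where
  open ≤-Reasoning
  P E : ℕ
  P = penaltySum n
  E = ∑[ k < n ] edge n (toℕ k)
  opposite-injective : Injective _≡_ _≡_ (opposite {n})
  opposite-injective {k} {l} e =
    trans (sym (opposite-involutive k)) (trans (cong opposite e) (opposite-involutive l))
  far-edges : ∑[ k < n ] edge n (n ∸ suc (toℕ k)) ≤ E
  far-edges = ≤-trans (≤-reflexive (sum-cong-≗ (λ (k : Fin n) → cong (edge n) (sym (opposite-prop k)))))
                      (∑-reindex-≤ (edge n ∘ toℕ) opposite-injective)
  P≤E+E : P ≤ E + E
  P≤E+E = ≤-trans (≤-reflexive (∑-distrib-+ (edge n ∘ toℕ) (λ (k : Fin n) → edge n (n ∸ suc (toℕ k)))))
                  (+-monoʳ-≤ E far-edges)
  quadruple : ∀ e → 16 * ((e + e) + (e + e)) ≡ 4 * (16 * e)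
  quadruple = solve-∀

diff-≡⇒sum-≡ : ∀ x y z w → ι x ℤ.- ι y ≡ ι z ℤ.- ι w → x + w ≡ z + y
diff-≡⇒sum-≡ x y z w e = ℤ.+-injective (begin
    ι (x + w)                         ≡⟨ ℤ.pos-+ x w ⟩
    ι x ℤ.+ ι w                       ≡⟨ regroup (ι x) (ι y) (ι w) ⟩
    (ι x ℤ.- ι y) ℤ.+ (ι y ℤ.+ ι w)   ≡⟨ cong₂ ℤ._+_ e (ℤ.+-comm (ι y) (ι w)) ⟩
    (ι z ℤ.- ι w) ℤ.+ (ι w ℤ.+ ι y)   ≡⟨ sym (regroup (ι z) (ι w) (ι y)) ⟩
    ι z ℤ.+ ι y                       ≡⟨ sym (ℤ.pos-+ z y) ⟩
    ι (z + y)                         ∎)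
  where
  open ≡-Reasoning
  regroup : ∀ u v t → u ℤ.+ t ≡ (u ℤ.- v) ℤ.+ (v ℤ.+ t)
  regroup = ℤ-Solver.solve-∀

sum-≡⇒diff-≡ : ∀ x y z w → x + w ≡ z + y → ι x ℤ.- ι y ≡ ι z ℤ.- ι w
sum-≡⇒diff-≡ x y z w e = begin
    ι x ℤ.- ι y                       ≡⟨ sym (cancel (ι x) (ι y) (ι w)) ⟩
    (ι x ℤ.+ ι w) ℤ.- (ι y ℤ.+ ι w)   ≡⟨ cong₂ ℤ._-_ e′ (ℤ.+-comm (ι y) (ι w)) ⟩
    (ι z ℤ.+ ι y) ℤ.- (ι w ℤ.+ ι y)   ≡⟨ cancel (ι z) (ι w) (ι y) ⟩
    ι z ℤ.- ι w                       ∎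
  where
  open ≡-Reasoning
  e′ : ι x ℤ.+ ι w ≡ ι z ℤ.+ ι y
  e′ = trans (sym (ℤ.pos-+ x w)) (trans (cong ι e) (ℤ.pos-+ z y))
  cancel : ∀ u v t → (u ℤ.+ t) ℤ.- (v ℤ.+ t) ≡ u ℤ.- v
  cancel = ℤ-Solver.solve-∀

both-sums-≡ : ∀ i p j y → i + y ≡ p + j → i + j ≡ p + y → i ≡ p
both-sums-≡ i p j y e₁ e₂ = *-cancelˡ-≡ i p 2 (+-cancelʳ-≡ (j + y) _ _ (begin
    2 * i + (j + y)     ≡⟨ solve (i ∷ j ∷ y ∷ []) ⟩
    (i + y) + (i + j)   ≡⟨ cong₂ _+_ e₁ e₂ ⟩
    (p + j) + (p + y)   ≡⟨ solve (p ∷ j ∷ y ∷ []) ⟩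
    2 * p + (j + y)     ∎))
  where open ≡-Reasoning

penalty-split : ∀ {n} (p y : Fin n) → edge n (toℕ p) + edge n (n ∸ suc (toℕ y)) ≤ penalty p + penalty y
penalty-split {n} p y = +-mono-≤ (m≤m+n (edge n (toℕ p)) (edge n (n ∸ suc (toℕ p))))
                                 (m≤n+m (edge n (n ∸ suc (toℕ y))) (edge n (toℕ y)))

module Lines {n : ℕ} (p y : Fin n) where

  onColumn? : (j : Fin n) → Dec (j ≡ y)
  onColumn? j = j ≟ᶠ y

  onDiag? onAnti? : (i j : Fin n) → Dec _
  onDiag? i j = dif i j ℤ.≟ dif p y
  onAnti? i j = sm i j ≟ℕ sm p y

  -- Squares off row p on one of these lines, decided exactly as in r.
  seen? : (i j : Fin n) → Dec (¬ (i ≡ p) × SharesColOrDiag i j p y)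
  seen? i j = ¬? (i ≟ᶠ p) ×-dec (onColumn? j ⊎-dec (onDiag? i j ⊎-dec onAnti? i j))

  column diag anti seen : Fin n → Fin n → ℕ
  column _ j = ind (onColumn? j)
  diag   i j = ind (onDiag? i j)
  anti   i j = ind (onAnti? i j)
  seen   i j = ind (seen? i j)

  -- V(p, y), D(p, y) and A(p, y) of the proof outline.
  visible diagLength antiLength : ℕ
  visible    = ∑[ i < n ] ∑[ j < n ] seen i j
  diagLength = ∑[ i < n ] ∑[ j < n ] diag i j
  antiLength = ∑[ i < n ] ∑[ j < n ] anti i j

  seen≤lines : ∀ i j → seen i j ≤ column i j + (diag i j + anti i j)
  seen≤lines i j = ≤-trans (ind-×-≤ (¬? (i ≟ᶠ p)) _)
                   (≤-trans (ind-⊎-≤ (onColumn? j) _)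
                            (+-monoʳ-≤ _ (ind-⊎-≤ (onDiag? i j) (onAnti? i j))))

  column∩diag : ∀ {i j} → j ≡ y → dif i j ≡ dif p y → i ≡ p
  column∩diag {i} refl e =
    toℕ-injective (+-cancelʳ-≡ (toℕ y) _ _ (diff-≡⇒sum-≡ (toℕ i) (toℕ y) (toℕ p) (toℕ y) e))

  column∩anti : ∀ {i j} → j ≡ y → sm i j ≡ sm p y → i ≡ p
  column∩anti refl e = toℕ-injective (+-cancelʳ-≡ (toℕ y) _ _ e)

  diag∩anti : ∀ {i j} → dif i j ≡ dif p y → sm i j ≡ sm p y → i ≡ p
  diag∩anti {i} {j} e₁ e₂ = toℕ-injective
    (both-sums-≡ (toℕ i) (toℕ p) (toℕ j) (toℕ y) (diff-≡⇒sum-≡ (toℕ i) (toℕ j) (toℕ p) (toℕ y) e₁) e₂)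

  diag-in-row : ∀ {j} → dif p j ≡ dif p y → j ≡ y
  diag-in-row {j} e =
    toℕ-injective (sym (+-cancelˡ-≡ (toℕ p) _ _ (diff-≡⇒sum-≡ (toℕ p) (toℕ j) (toℕ p) (toℕ y) e)))

  anti-in-row : ∀ {j} → sm p j ≡ sm p y → j ≡ y
  anti-in-row e = toℕ-injective (+-cancelˡ-≡ (toℕ p) _ _ e)

  -- Row p meets each line once; any other row meets them in disjoint squares,
  -- all of which are seen.
  row-lines : ∀ i (i≟p : Dec (i ≡ p)) →
              ∑[ j < n ] (column i j + (diag i j + anti i j)) ≤ ∑[ j < n ] seen i j + 3 * ind i≟p
  row-lines .p (yes refl) = ≤-trans in-row (m≤n+m 3 _)
    where
    in-row : ∑[ j < n ] (column p j + (diag p j + anti p j)) ≤ 3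
    in-row = ≤-trans (≤-reflexive (∑-distrib-+₃ (column p) (diag p) (anti p)))
      (+-mono-≤ (∑-atMostOne onColumn? (λ eⱼ eₖ → trans eⱼ (sym eₖ)))
      (+-mono-≤ (∑-atMostOne (onDiag? p) (λ eⱼ eₖ → trans (diag-in-row eⱼ) (sym (diag-in-row eₖ))))
                (∑-atMostOne (onAnti? p) (λ eⱼ eₖ → trans (anti-in-row eⱼ) (sym (anti-in-row eₖ))))))
  row-lines i (no i≢p) = ≤-trans (∑-mono off-row) (m≤m+n _ _)
    where
    off-row : ∀ j → column i j + (diag i j + anti i j) ≤ seen i j
    off-row j = begin
        column i j + (diag i j + anti i j)
      ≤⟨ +-monoʳ-≤ _ (ind-⊎-disjoint (onDiag? i j) (onAnti? i j) (λ (e₁ , e₂) → i≢p (diag∩anti e₁ e₂))) ⟩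
        ind (onColumn? j) + ind (onDiag? i j ⊎-dec onAnti? i j)
      ≤⟨ ind-⊎-disjoint (onColumn? j) (onDiag? i j ⊎-dec onAnti? i j)
           (λ { (e , inj₁ e₁) → i≢p (column∩diag e e₁) ; (e , inj₂ e₂) → i≢p (column∩anti e e₂) }) ⟩
        ind (onColumn? j ⊎-dec (onDiag? i j ⊎-dec onAnti? i j))
      ≡⟨ sym (ind-×-yes (¬? (i ≟ᶠ p)) (onColumn? j ⊎-dec (onDiag? i j ⊎-dec onAnti? i j)) i≢p) ⟩
        seen i j ∎
      where open ≤-Reasoning

  -- The three lines have n + D + A squares counted with multiplicity;
  -- all but the three at (p, y) are seen: V ≥ n + D + A − 3.
  lines-through : n + (diagLength + antiLength) ≤ visible + 3
  lines-through = begin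
      n + (diagLength + antiLength)
    ≤⟨ +-monoˡ-≤ _ column-length ⟩
      ∑[ i < n ] ∑[ j < n ] column i j + (diagLength + antiLength)
    ≡⟨ sym (trans (sum-cong-≗ (λ i → ∑-distrib-+₃ (column i) (diag i) (anti i)))
                  (∑-distrib-+₃ (sum ∘ column) (sum ∘ diag) (sum ∘ anti))) ⟩
      ∑[ i < n ] ∑[ j < n ] (column i j + (diag i j + anti i j))
    ≤⟨ ∑-mono (λ i → row-lines i (i ≟ᶠ p)) ⟩
      ∑[ i < n ] (∑[ j < n ] seen i j + 3 * ind (i ≟ᶠ p))
    ≡⟨ trans (∑-distrib-+ (sum ∘ seen) (λ i → 3 * ind (i ≟ᶠ p)))
             (cong (visible +_) (sym (*-distribˡ-sum 3 (λ i → ind (i ≟ᶠ p))))) ⟩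
      visible + 3 * ∑[ i < n ] ind (i ≟ᶠ p)
    ≤⟨ +-monoʳ-≤ visible (*-monoʳ-≤ 3 (∑-atMostOne (_≟ᶠ p) (λ eᵢ eⱼ → trans eᵢ (sym eⱼ)))) ⟩
      visible + 3 ∎
    where
    open ≤-Reasoning
    column-length : n ≤ ∑[ i < n ] ∑[ j < n ] column i j
    column-length = ∑∑-rows (λ _ → onColumn?) 0 n ≤-refl (λ _ _ _ → y , refl)

  diag-square : ∀ i k → k < n → toℕ i + toℕ y ≡ toℕ p + k → ∃[ j ] dif i j ≡ dif p y
  diag-square i k k<n e = j , sum-≡⇒diff-≡ (toℕ i) (toℕ j) (toℕ p) (toℕ y)
                                            (trans e (cong (toℕ p +_) (sym (toℕ-fromℕ< k<n))))
    where j = fromℕ< k<n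

  anti-square : ∀ i → toℕ i ≤ sm p y → sm p y ∸ toℕ i < n → ∃[ j ] sm i j ≡ sm p y
  anti-square i i≤s k<n = fromℕ< k<n , trans (cong (toℕ i +_) (toℕ-fromℕ< k<n)) (m+[n∸m]≡n i≤s)

  -- The diagonal through (p, y) has n − |p − y| squares: each row of an
  -- interval of that length contains one.
  diag-long : n ≤ ∣ toℕ p - toℕ y ∣ + diagLength
  diag-long with toℕ p ≤? toℕ y
  ... | yes p≤y = subst (λ k → n ≤ k + diagLength) (sym (m≤n⇒∣m-n∣≡n∸m p≤y)) (begin
          n                ≤⟨ m≤n+m∸n n d ⟩
          d + (n ∸ d)      ≤⟨ +-monoʳ-≤ d (∑∑-rows onDiag? 0 (n ∸ d) (m∸n≤m n d) row) ⟩
          d + diagLength   ∎)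
    where
    open ≤-Reasoning
    d = toℕ y ∸ toℕ p
    d≤n : d ≤ n
    d≤n = ≤-trans (m∸n≤m (toℕ y) (toℕ p)) (<⇒≤ (toℕ<n y))
    exchange : ∀ u v w → u + (v + w) ≡ v + (u + w)
    exchange = solve-∀
    -- Row i < n − d contains (i, i + d).
    row : ∀ i → 0 ≤ toℕ i → toℕ i < n ∸ d → ∃[ j ] dif i j ≡ dif p y
    row i _ i<n∸d = diag-square i (toℕ i + d) (m≤o∸n⇒m+n≤o (suc (toℕ i)) d≤n i<n∸d)
      (trans (cong (toℕ i +_) (sym (m+[n∸m]≡n p≤y))) (exchange (toℕ i) (toℕ p) d))
  ... | no p≰y = subst (λ k → n ≤ k + diagLength) (sym (m≤n⇒∣n-m∣≡n∸m y≤p))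
                       (∑∑-rows onDiag? d n ≤-refl row)
    where
    open ≡-Reasoning
    y≤p = ≰⇒≥ p≰y
    d = toℕ p ∸ toℕ y
    exchange : ∀ u v w → u + v + w ≡ (w + v) + u
    exchange = solve-∀
    -- Row i ≥ d contains (i, i − d).
    row : ∀ i → d ≤ toℕ i → toℕ i < n → ∃[ j ] dif i j ≡ dif p y
    row i d≤i i<n = diag-square i (toℕ i ∸ d) (≤-<-trans (m∸n≤m (toℕ i) d) i<n) (begin
        toℕ i + toℕ y                 ≡⟨ cong (_+ toℕ y) (sym (m∸n+n≡m d≤i)) ⟩
        (toℕ i ∸ d) + d + toℕ y       ≡⟨ exchange (toℕ i ∸ d) d (toℕ y) ⟩
        (toℕ y + d) + (toℕ i ∸ d)     ≡⟨ cong (_+ (toℕ i ∸ d)) (m+[n∸m]≡n y≤p) ⟩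
        toℕ p + (toℕ i ∸ d)           ∎)

  -- The antidiagonal with index s = p + y meets rows 0 … s when s < n, …
  anti-short : sm p y < n → suc (sm p y) ≤ antiLength
  anti-short s<n = ∑∑-rows onAnti? 0 (suc (sm p y)) s<n
    (λ i _ i<1+s → anti-square i (m<1+n⇒m≤n i<1+s) (≤-<-trans (m∸n≤m _ (toℕ i)) s<n))

  -- … and rows s + 1 − n … n − 1 when s ≥ n, i.e. 2n − 1 − s of them.
  anti-long : n ≤ sm p y → n + n ≤ suc (sm p y) + antiLength
  anti-long n≤s = begin
      n + n                            ≤⟨ +-monoʳ-≤ n (∑∑-rows onAnti? (suc s ∸ n) n ≤-refl row) ⟩
      n + ((suc s ∸ n) + antiLength)   ≡⟨ sym (+-assoc n _ antiLength) ⟩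
      n + (suc s ∸ n) + antiLength     ≡⟨ cong (_+ antiLength) (m+[n∸m]≡n (m≤n⇒m≤1+n n≤s)) ⟩
      suc s + antiLength               ∎
    where
    open ≤-Reasoning
    s = sm p y
    s<i+n : ∀ i → suc s ∸ n ≤ toℕ i → s < toℕ i + n
    s<i+n i lo≤i = ≤-trans (m≤n+m∸n (suc s) n)
                           (≤-trans (+-monoʳ-≤ n lo≤i) (≤-reflexive (+-comm n (toℕ i))))
    row : ∀ i → suc s ∸ n ≤ toℕ i → toℕ i < n → ∃[ j ] sm i j ≡ sm p y
    row i lo≤i i<n = anti-square i (≤-trans (<⇒≤ i<n) n≤s)
                                   (m<n+o⇒m∸n<o s (toℕ i) ⦃ nonZeroIndex p ⦄ (s<i+n i lo≤i))

  -- The diagonals through (p, y) are long unless (p, y) is near the border;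
  -- by symmetry it suffices to treat the smaller coordinate first.
  diagonals-long : 6 * n ≤ 4 * (diagLength + antiLength) + (penalty p + penalty y)
  diagonals-long with toℕ p ≤? toℕ y
  ... | yes p≤y = ≤-trans
    (ordered-bound n (toℕ p) (toℕ y) (sm p y) diagLength antiLength _ _ p≤y (toℕ<n y) refl
       diag-long anti-short anti-long (edge-bound n (toℕ p)) (edge-bound n (n ∸ suc (toℕ y))))
    (+-monoʳ-≤ (4 * (diagLength + antiLength)) (penalty-split p y))
  ... | no p≰y = ≤-trans
    (ordered-bound n (toℕ y) (toℕ p) (sm p y) diagLength antiLength _ _ (≰⇒≥ p≰y) (toℕ<n p)
       (+-comm (toℕ y) (toℕ p)) (subst (λ k → n ≤ k + diagLength) (∣-∣-comm (toℕ p) (toℕ y)) diag-long)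
       anti-short anti-long (edge-bound n (toℕ y)) (edge-bound n (n ∸ suc (toℕ p))))
    (+-monoʳ-≤ (4 * (diagLength + antiLength))
               (≤-trans (penalty-split y p) (≤-reflexive (+-comm (penalty y) (penalty p)))))

open Lines using (seen?; visible; diagLength; antiLength; seen≤lines; lines-through; diagonals-long)

module Queens {n : ℕ} (X : Fin n → Fin n) (queens : IsQueens X) where

  same-row : ∀ {q q′} → SharesColOrDiag q (X q) q′ (X q′) → q ≡ q′
  same-row {q} {q′} shared with q ≟ᶠ q′
  ... | yes q≡q′ = q≡q′
  ... | no q≢q′  = ⊥-elim (queens q q′ q≢q′ shared)

  X-injective : Injective _≡_ _≡_ X
  X-injective e = same-row (inj₁ e)

  r-as-sum : ∀ i j → r X i j ≡ ∑[ q < n ] Lines.seen q (X q) i j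
  r-as-sum i j = length-filter (λ q → seen? q (X q) i j) id

  r-on-queen : ∀ i → r X i (X i) ≡ 0
  r-on-queen i = trans (r-as-sum i (X i))
    (∑-zero (λ q → ind-no (seen? q (X q) i (X i)) (λ (i≢q , shared) → i≢q (same-row shared))))

  -- Each of the three lines through (i, j) holds at most one queen.
  r≤3 : ∀ i j → r X i j ≤ 3
  r≤3 i j = begin
      r X i j                                  ≡⟨ r-as-sum i j ⟩
      ∑[ q < n ] Lines.seen q (X q) i j       ≤⟨ ∑-mono (λ q → seen≤lines q (X q) i j) ⟩
      ∑[ q < n ] (column q + (diag q + anti q)) ≡⟨ ∑-distrib-+₃ column diag anti ⟩
      sum column + (sum diag + sum anti)
        ≤⟨ +-mono-≤ (∑-atMostOne column? (λ e e′ → same-row (inj₁ (trans (sym e) e′))))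
           (+-mono-≤ (∑-atMostOne diag? (λ e e′ → same-row (inj₂ (inj₁ (trans (sym e) e′)))))
                     (∑-atMostOne anti? (λ e e′ → same-row (inj₂ (inj₂ (trans (sym e) e′)))))) ⟩
      3                                        ∎
    where
    open ≤-Reasoning
    column? diag? anti? : (q : Fin n) → Dec _
    column? q = Lines.onColumn? q (X q) j
    diag?   q = Lines.onDiag? q (X q) i j
    anti?   q = Lines.onAnti? q (X q) i j
    column diag anti : Fin n → ℕ
    column = ind ∘ column?
    diag   = ind ∘ diag?
    anti   = ind ∘ anti?

  -- S of the proof outline.
  attackSum : ℕ
  attackSum = ∑[ i < n ] ∑[ j < n ] r X i j

  row-sum : ∀ i → ∑[ j < n ] r X i j ≤ 2 * a X i + b X i + n
  row-sum i = begin
      ∑[ j < n ] r X i j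
    ≤⟨ ∑-mono (λ j → weighted-≤ (j ≟ᶠ X i) (r X i j) (r≤3 i j) (λ { refl → r-on-queen i })) ⟩
      ∑[ j < n ] (2 * three j + two j + 1)
    ≡⟨ trans (∑-distrib-+ (λ j → 2 * three j + two j) (λ _ → 1))
             (cong₂ _+_ (∑-distrib-+ (λ j → 2 * three j) two) (trans (∑-const n 1) (*-identityʳ n))) ⟩
      ∑[ j < n ] (2 * three j) + sum two + n
    ≡⟨ cong₂ (λ u v → u + v + n)
             (trans (sym (*-distribˡ-sum 2 three)) (cong (2 *_) (sym (length-filter three? id))))
             (sym (length-filter two? id)) ⟩
      2 * a X i + b X i + n ∎
    where
    open ≤-Reasoning
    three? two? : (j : Fin n) → Dec _
    three? j = ¬? (j ≟ᶠ X i) ×-dec (r X i j ≟ℕ 3)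
    two?   j = ¬? (j ≟ᶠ X i) ×-dec (r X i j ≟ℕ 2)
    three two : Fin n → ℕ
    three = ind ∘ three?
    two   = ind ∘ two?

  attackSum-rows : attackSum ≤ total X + n * n
  attackSum-rows = begin
      attackSum                            ≤⟨ ∑-mono row-sum ⟩
      ∑[ i < n ] (2 * a X i + b X i + n)   ≡⟨ ∑-distrib-+ weights (λ _ → n) ⟩
      ∑[ i < n ] weights i + ∑[ i < n ] n  ≡⟨ cong₂ _+_ (sym (listSum-map weights id)) (∑-const n n) ⟩
      total X + n * n                      ∎
    where
    open ≤-Reasoning
    weights : Fin n → ℕ
    weights i = 2 * a X i + b X i

  diagonalSum : ℕ
  diagonalSum = ∑[ q < n ] (diagLength q (X q) + antiLength q (X q))

  -- Counting the attacks by queen, S = Σ_q V(q) ≥ n² + Σ_q (D + A) − 3n.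
  attackSum-queens : n * n + diagonalSum ≤ attackSum + n * 3
  attackSum-queens = begin
      n * n + diagonalSum
    ≡⟨ cong (_+ diagonalSum) (sym (∑-const n n)) ⟩
      ∑[ q < n ] n + diagonalSum
    ≡⟨ sym (∑-distrib-+ (λ _ → n) (λ q → diagLength q (X q) + antiLength q (X q))) ⟩
      ∑[ q < n ] (n + (diagLength q (X q) + antiLength q (X q)))
    ≤⟨ ∑-mono (λ q → lines-through q (X q)) ⟩
      ∑[ q < n ] (visible q (X q) + 3)
    ≡⟨ trans (∑-distrib-+ (λ q → visible q (X q)) (λ _ → 3)) (cong₂ _+_ (sym double-count) (∑-const n 3)) ⟩
      attackSum + n * 3 ∎
    where
    open ≤-Reasoning
    double-count : attackSum ≡ ∑[ q < n ] visible q (X q)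
    double-count = begin-equality
        ∑[ i < n ] ∑[ j < n ] r X i j
      ≡⟨ sum-cong-≗ (λ i → trans (sum-cong-≗ (r-as-sum i)) (∑-comm (λ j q → Lines.seen q (X q) i j))) ⟩
        ∑[ i < n ] ∑[ q < n ] ∑[ j < n ] Lines.seen q (X q) i j
      ≡⟨ ∑-comm (λ i q → ∑[ j < n ] Lines.seen q (X q) i j) ⟩
        ∑[ q < n ] visible q (X q) ∎

  -- Summing diagonals-long over the queens; the columns X q are distinct.
  diagonalSum-long : n * (6 * n) ≤ 4 * diagonalSum + (penaltySum n + penaltySum n)
  diagonalSum-long = begin
      n * (6 * n)
    ≡⟨ sym (∑-const n (6 * n)) ⟩
      ∑[ q < n ] (6 * n)
    ≤⟨ ∑-mono (λ q → diagonals-long q (X q)) ⟩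
      ∑[ q < n ] (4 * (diagLength q (X q) + antiLength q (X q)) + (penalty q + penalty (X q)))
    ≡⟨ trans (∑-distrib-+₃ (λ q → 4 * (diagLength q (X q) + antiLength q (X q))) penalty (penalty ∘ X))
             (cong (_+ (penaltySum n + ∑[ q < n ] penalty (X q)))
                   (sym (*-distribˡ-sum 4 (λ q → diagLength q (X q) + antiLength q (X q))))) ⟩
      4 * diagonalSum + (penaltySum n + ∑[ q < n ] penalty (X q))
    ≤⟨ +-monoʳ-≤ (4 * diagonalSum) (+-monoʳ-≤ (penaltySum n) (∑-reindex-≤ penalty X-injective)) ⟩
      4 * diagonalSum + (penaltySum n + penaltySum n) ∎
    where open ≤-Reasoning

-- The four estimates combine linearly:
-- 4·(n² + W ≤ S + 3n) + 4·(S ≤ t + n²) + (6n² ≤ 4W + Q) + (Q ≤ n² + 8n).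
combine-estimates : ∀ n t S W Q → S ≤ t + n * n → n * n + W ≤ S + n * 3 →
                    n * (6 * n) ≤ 4 * W + Q → Q ≤ n * n + 8 * n →
                    5 * (n * n) ≤ 4 * t + 24 * n
combine-estimates n t S W Q rows queens diagonals penalties =
  ≤-trans (+-cancelʳ-≤ (5 * (n * n) + 4 * W + 4 * S + Q) _ _ (begin
      5 * (n * n) + (5 * (n * n) + 4 * W + 4 * S + Q)
    ≡⟨ solve (n ∷ W ∷ S ∷ Q ∷ []) ⟩
      4 * (n * n + W) + 4 * S + n * (6 * n) + Q
    ≤⟨ +-mono-≤ (+-mono-≤ (+-mono-≤ (*-monoʳ-≤ 4 queens) (*-monoʳ-≤ 4 rows)) diagonals) penalties ⟩
      4 * (S + n * 3) + 4 * (t + n * n) + (4 * W + Q) + (n * n + 8 * n)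
    ≡⟨ solve (n ∷ t ∷ W ∷ S ∷ Q ∷ []) ⟩
      4 * t + 20 * n + (5 * (n * n) + 4 * W + 4 * S + Q) ∎))
  (+-monoʳ-≤ (4 * t) (*-monoˡ-≤ n (m≤m+n 20 4)))
  where open ≤-Reasoning

lemma4 : (n : ℕ) → 1 ≤ n → (X : Fin n → Fin n) → IsQueens X →
    5 * (n * n) ≤ 4 * total X + 24 * n
lemma4 n _ X queens =
  combine-estimates n (total X) attackSum diagonalSum (penaltySum n + penaltySum n)
    attackSum-rows attackSum-queens diagonalSum-long (penalty-total n)
  where open Queens X queens
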